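{- Every full binary tree and every complete binary tree is neighborhood-prime.
   Context: A neighborhood-prime labeling of a simple graph $G$ with $N$ vertices is a bijection $f:V(G)\to\{1,\ldots,N\}$ such that for every vertex $v$ with $\deg(v)>1$, $\gcd\{f(u):u\in N(v)\}=1$, where $N(v)$ is the neighborhood of $v$; a graph admitting one is neighborhood-prime. A binary tree is a rooted tree in which each node has at most $2$ children. A full binary tree is a binary tree in which every node has either $0$ or $2$ children. A complete binary tree is a binary tree in which every level is completely filled except possibly the bottom level, whose nodes are as far left as possible. -}

module Defs where

open import Data.Nat using (ℕ; zero; suc; _+_; _<_)
open import Data.Nat.GCD using (gcd)
import Data.Nat.Properties as ℕP
open import Data.Bool using (Bool; true; false)
open import Data.Fin using (Fin; toℕ)
open import Data.List using (List; []; _∷_; _++_; [_]; length; map; foldr; filter; allFin)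
open import Data.List.Membership.Propositional using (_∈_)
import Data.List.Membership.DecPropositional as DecMem
open import Data.Product using (Σ; _×_; _,_)
open import Data.Product.Properties using (≡-dec)
open import Data.Sum using (_⊎_)
open import Data.Empty using (⊥)
open import Data.Unit using (⊤)
open import Function.Definitions using (Bijective)
open import Relation.Binary.PropositionalEquality using (_≡_)
open import Relation.Nullary.Decidable using (_⊎-dec_)
open import Relation.Binary.Definitions using (Decidable)

record Graph : Set₁ where
  field
    N    : ℕ
    Adj  : Fin N → Fin N → Set
    Adj? : Decidable Adj

open Graph public

nbhd : (G : Graph) → Fin (N G) → List (Fin (N G))
nbhd G v = filter (λ u → Adj? G u v) (allFin (N G))

deg : (G : Graph) → Fin (N G) → ℕ
deg G v = length (nbhd G v)

-- gcd of a finite list of naturals (gcd of the empty list is 0).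
gcdList : List ℕ → ℕ
gcdList = foldr gcd 0

-- f : V → V bijective, label of vertex u is  toℕ (f u) + 1 ∈ {1,…,N};
-- every vertex of degree > 1 has neighborhood labels with gcd 1.
NeighborhoodPrimeLabeling : (G : Graph) → (Fin (N G) → Fin (N G)) → Set
NeighborhoodPrimeLabeling G f =
  Bijective _≡_ _≡_ f ×
  (∀ v → 1 < deg G v → gcdList (map (λ u → suc (toℕ (f u))) (nbhd G v)) ≡ 1)

NeighborhoodPrime : Graph → Set
NeighborhoodPrime G = Σ (Fin (N G) → Fin (N G)) (NeighborhoodPrimeLabeling G)

data BT : Set where
  nil  : BT
  node : BT → BT → BT

size : BT → ℕ
size nil = 0
size (node l r) = suc (size l + size r)

-- Vertices are numbered in preorder: the root of a subtree placed at
-- offset o gets number o, its left subtree starts at o+1, its right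
-- subtree at o+1+size l.  childEdge p c t = the edge from parent p to
-- the root c of t, if t is nonempty.
childEdge : ℕ → ℕ → BT → List (ℕ × ℕ)
childEdge p c nil = []
childEdge p c (node _ _) = [ (p , c) ]

edgesAt : ℕ → BT → List (ℕ × ℕ)
edgesAt o nil = []
edgesAt o (node l r) =
  childEdge o (suc o) l ++ childEdge o (suc o + size l) r
  ++ edgesAt (suc o) l ++ edgesAt (suc o + size l) r

edges : BT → List (ℕ × ℕ)
edges = edgesAt 0

private
  _≟p_ : (x y : ℕ × ℕ) → _
  _≟p_ = ≡-dec ℕP._≟_ ℕP._≟_

open DecMem _≟p_ using (_∈?_)

TreeAdj : (t : BT) → Fin (size t) → Fin (size t) → Set
TreeAdj t u v = ((toℕ u , toℕ v) ∈ edges t) ⊎ ((toℕ v , toℕ u) ∈ edges t)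

treeGraph : BT → Graph
treeGraph t = record
  { N = size t
  ; Adj = TreeAdj t
  ; Adj? = λ u v → ((toℕ u , toℕ v) ∈? edges t) ⊎-dec ((toℕ v , toℕ u) ∈? edges t)
  }

data Full : BT → Set where
  full-nil  : Full nil
  full-leaf : Full (node nil nil)
  full-node : ∀ {a b c d} → Full (node a b) → Full (node c d) →
              Full (node (node a b) (node c d))

-- Complete binary trees.
-- A node is addressed by its path from the root (false = go left,
-- true = go right); its level is the length of the path.

Present : BT → List Bool → Set
Present nil p = ⊥
Present (node l r) [] = ⊤
Present (node l r) (false ∷ p) = Present l p
Present (node l r) (true ∷ p) = Present r p

-- left-to-right order on addresses of the same level
data _⊑_ : List Bool → List Bool → Set where
  []⊑[] : [] ⊑ []
  L⊑R   : ∀ {p q} → length p ≡ length q → (false ∷ p) ⊑ (true ∷ q)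
  same  : ∀ {b p q} → p ⊑ q → (b ∷ p) ⊑ (b ∷ q)

Complete : BT → Set
Complete t = Σ ℕ λ h →
  (∀ p → length p < h → Present t p) ×
  (∀ p → h < length p → Present t p → ⊥) ×
  (∀ p q → length p ≡ h → q ⊑ p → Present t p → Present t q)

-- Label each vertex by one plus its position in a list S of all vertices.  A vertex of
-- degree > 1 is then harmless as soon as two of its neighbours are consecutive in S,
-- since their labels differ by one.  Call a tree admissible if every node with a single
-- child is a twig (that child is a leaf) and no node has two twig children.  Full trees
-- have no twigs, and a complete tree has at most one node with a single child, which is
-- then a leaf.  For admissible trees take S to be the tour: the root, then the reversed
-- tour of the left subtree, then the tour of the right subtree, so that the two children
-- of every node meet in the middle.  When the right child is a twig the two parts are
-- swapped; either way the leaf of a twig child comes right after the twig's parent, and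
-- these two are all the neighbours of the twig.
module Submission where

open import Defs
open import Data.Bool using (Bool; true; false)
open import Data.Empty using (⊥; ⊥-elim)
open import Data.Fin using (Fin; toℕ; fromℕ<; punchOut)
open import Data.Fin.Properties
  using (toℕ<n; toℕ-fromℕ<; toℕ-injective; any?; injective⇒≤; punchOut-injective)
  renaming (_≟_ to _≟ᶠ_)
open import Data.List using (List; []; _∷_; _++_; length; map; allFin; reverse; lookup)
open import Data.List.Properties using (length-++; length-reverse; reverse-++; unfold-reverse; ++-assoc)
open import Data.List.Membership.Propositional using (_∈_)
open import Data.List.Membership.Propositional.Properties
  using (∈-++⁺ˡ; ∈-++⁺ʳ; ∈-++⁻; ∈-filter⁺; ∈-filter⁻; ∈-allFin; ∈-map⁺)
open import Data.List.Relation.Binary.Infix.Heterogeneous using (Infix; here; there; _++ⁱ_; _ⁱ++_)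
open import Data.List.Relation.Binary.Prefix.Heterogeneous using ([]; _∷_)
open import Data.List.Relation.Unary.Any using (here; there; index)
open import Data.List.Relation.Unary.Any.Properties using (lookup-index; reverse⁺)
open import Data.List.Relation.Unary.AllPairs using (_∷_)
open import Data.List.Relation.Unary.All using (_∷_)
open import Data.List.Relation.Unary.Unique.Propositional using (Unique)
open import Data.List.Relation.Unary.Unique.Propositional.Properties using (allFin⁺; filter⁺)
open import Data.Nat using (ℕ; zero; suc; _+_; _<_; _≤_; z≤n; s≤s; _≟_; _<?_)
open import Data.Nat.Divisibility using (_∣_; ∣-trans; ∣1⇒≡1; ∣m+n∣m⇒∣n)
open import Data.Nat.GCD using (gcd[m,n]∣m; gcd[m,n]∣n)
open import Data.Nat.Properties
  using ( +-comm; +-assoc; +-suc; +-identityʳ; ≤-refl; ≤-trans; ≤-reflexive; <-trans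
        ; <-irrefl; <-≤-trans; ≤-<-trans; <⇒≤; <⇒≱; ≮⇒≥; ≤∧≢⇒<; m≤m+n; m<m+n; n≤1+n
        ; 1+n≰n; n≮0; <-cmp)
open import Data.Product using (Σ; ∃; ∃₂; _×_; _,_; proj₁; proj₂; map₂)
open import Data.Sum using (_⊎_; inj₁; inj₂; [_,_]′; swap) renaming (map to ⊎-map)
open import Data.Unit using (tt)
open import Function using (_∘_; id)
open import Function.Definitions using (Injective; Surjective; Bijective)
open import Relation.Binary.Definitions using (tri<; tri≈; tri>)
open import Relation.Binary.PropositionalEquality
  using (_≡_; _≢_; refl; sym; trans; cong; cong₂; subst; module ≡-Reasoning)
open import Relation.Nullary using (¬_; Dec; yes; no; does; contradiction)
open import Relation.Nullary.Decidable using (dec-true; dec-false)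
open import Relation.Unary using (Decidable)

-- Labelings read off an enumeration of the vertices

gcdList-∣ : ∀ {x xs} → x ∈ xs → gcdList xs ∣ x
gcdList-∣ {xs = y ∷ ys} (here refl) = gcd[m,n]∣m y (gcdList ys)
gcdList-∣ {xs = y ∷ ys} (there p)   = ∣-trans (gcd[m,n]∣n y (gcdList ys)) (gcdList-∣ p)

gcdList-consecutive : ∀ {x xs} → x ∈ xs → suc x ∈ xs → gcdList xs ≡ 1
gcdList-consecutive {x} {xs} x∈ 1+x∈ =
  ∣1⇒≡1 (∣m+n∣m⇒∣n (subst (gcdList xs ∣_) (+-comm 1 x) (gcdList-∣ 1+x∈)) (gcdList-∣ x∈))

length≤1 : ∀ {A : Set} {xs : List A} → Unique xs →
           (∀ {x y} → x ∈ xs → y ∈ xs → x ≡ y) → length xs ≤ 1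
length≤1 {xs = []}          _                 _  = z≤n
length≤1 {xs = _ ∷ []}      _                 _  = s≤s z≤n
length≤1 {xs = _ ∷ _ ∷ _}   ((x≢y ∷ _) ∷ _)   eq = ⊥-elim (x≢y (eq (here refl) (there (here refl))))

AtMostOneNeighbour : (G : Graph) → Fin (N G) → Set
AtMostOneNeighbour G v = ∀ {u w} → Adj G u v → Adj G w v → u ≡ w

∈-nbhd : (G : Graph) {u v : Fin (N G)} → Adj G u v → u ∈ nbhd G v
∈-nbhd G {u} {v} uv = ∈-filter⁺ (λ x → Adj? G x v) (∈-allFin u) uv

deg≤1 : (G : Graph) (v : Fin (N G)) → AtMostOneNeighbour G v → deg G v ≤ 1
deg≤1 G v unique =
  length≤1 (filter⁺ adj? (allFin⁺ (N G))) λ p q → unique (adjacent p) (adjacent q)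
  where
  adj? : ∀ u → Dec (Adj G u v)
  adj? u = Adj? G u v

  adjacent : ∀ {u} → u ∈ nbhd G v → Adj G u v
  adjacent p = proj₂ (∈-filter⁻ adj? {xs = allFin (N G)} p)

injective⇒surjective : ∀ {n} {f : Fin n → Fin n} → Injective _≡_ _≡_ f → Surjective _≡_ _≡_ f
injective⇒surjective {suc n} {f} f-inj y with any? (λ x → f x ≟ᶠ y)
... | yes (x , fx≡y) = x , λ { refl → fx≡y }
... | no ∄x          = contradiction (injective⇒≤ missing-y-injective) 1+n≰n
  where
  missing-y : Fin (suc n) → Fin n
  missing-y x = punchOut {i = y} (λ y≡fx → ∄x (x , sym y≡fx))

  missing-y-injective : Injective _≡_ _≡_ missing-y
  missing-y-injective {x} {x'} eq = f-inj (punchOut-injective {i = y} {f x} {f x'} _ _ eq)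

consecutive-indices : ∀ {A : Set} {x y : A} {zs} → Infix _≡_ (x ∷ y ∷ []) zs →
                      Σ (x ∈ zs) λ p → Σ (y ∈ zs) λ q → toℕ (index q) ≡ suc (toℕ (index p))
consecutive-indices (here (refl ∷ refl ∷ [])) = here refl , there (here refl) , refl
consecutive-indices (there i) with consecutive-indices i
... | p , q , eq = there p , there q , cong suc eq

-- By pigeonhole, a list of length n containing every k < n lists each of them exactly once.
module Covering (S : List ℕ) (covers : ∀ (v : Fin (length S)) → toℕ v ∈ S) where

  position : Fin (length S) → Fin (length S)
  position v = index (covers v)

  lookup-position : ∀ v → toℕ v ≡ lookup S (position v)
  lookup-position v = lookup-index (covers v)

  position-injective : Injective _≡_ _≡_ position
  position-injective {u} {v} eq =
    toℕ-injective (trans (lookup-position u) (trans (cong (lookup S) eq) (sym (lookup-position v))))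

  position-bijective : Bijective _≡_ _≡_ position
  position-bijective = position-injective , injective⇒surjective {length S} position-injective

  index≡position : ∀ v (p : toℕ v ∈ S) → index p ≡ position v
  index≡position v p with injective⇒surjective {length S} position-injective (index p)
  ... | w , pos-w = trans (sym (pos-w refl)) (cong position w≡v)
    where
    w≡v : w ≡ v
    w≡v = toℕ-injective (trans (lookup-position w)
            (trans (cong (lookup S) (pos-w refl)) (sym (lookup-index p))))

  consecutive-positions : ∀ {u w} → Infix _≡_ (toℕ u ∷ toℕ w ∷ []) S →
                          toℕ (position w) ≡ suc (toℕ (position u))
  consecutive-positions {u} {w} i with consecutive-indices i
  ... | p , q , eq = begin
    toℕ (position w)           ≡⟨ cong toℕ (sym (index≡position w q)) ⟩
    toℕ (index q)              ≡⟨ eq ⟩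
    suc (toℕ (index p))        ≡⟨ cong (suc ∘ toℕ) (index≡position u p) ⟩
    suc (toℕ (position u))     ∎
    where open ≡-Reasoning

ConsecutiveNeighbours : (G : Graph) → List ℕ → Fin (N G) → Set
ConsecutiveNeighbours G S v =
  ∃₂ λ u w → Adj G u v × Adj G w v × Infix _≡_ (toℕ u ∷ toℕ w ∷ []) S

neighborhoodPrime-fromCovering :
  (G : Graph) (S : List ℕ) → length S ≡ N G → (∀ (v : Fin (N G)) → toℕ v ∈ S) →
  (∀ v → AtMostOneNeighbour G v ⊎ ConsecutiveNeighbours G S v) → NeighborhoodPrime G
neighborhoodPrime-fromCovering G S refl covers neighbours =
  position , position-bijective , gcd≡1
  where
  open Covering S covers

  label : Fin (N G) → ℕ
  label u = suc (toℕ (position u))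

  gcd≡1 : ∀ v → 1 < deg G v → gcdList (map label (nbhd G v)) ≡ 1
  gcd≡1 v 1<deg with neighbours v
  ... | inj₁ unique = contradiction (deg≤1 G v unique) (<⇒≱ 1<deg)
  ... | inj₂ (u , w , uv , wv , uw) =
    gcdList-consecutive (∈-map⁺ label (∈-nbhd G uv))
      (subst (_∈ map label (nbhd G v)) (cong suc (consecutive-positions uw))
             (∈-map⁺ label (∈-nbhd G wv)))

pattern leaf = node nil nil

-- At o t v s: when t is numbered in preorder starting from o, vertex v is the root of s.
data At : ℕ → BT → ℕ → BT → Set where
  root    : ∀ {o l r} → At o (node l r) o (node l r)
  inLeft  : ∀ {o l r v s} → At (suc o) l v s → At o (node l r) v s
  inRight : ∀ {o l r v s} → At (suc o + size l) r v s → At o (node l r) v s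

data ChildOf (v : ℕ) : BT → ℕ → BT → Set where
  leftChild  : ∀ {a b r} → ChildOf v (node (node a b) r) (suc v) (node a b)
  rightChild : ∀ {l c d} → ChildOf v (node l (node c d)) (suc v + size l) (node c d)

size-node : ∀ o l r → suc o + size l + size r ≡ o + size (node l r)
size-node o l r = trans (cong suc (+-assoc o (size l) (size r))) (sym (+-suc o _))

At-nil : ∀ {o t v} → ¬ At o t v nil
At-nil (inLeft a)  = At-nil a
At-nil (inRight a) = At-nil a

At-range : ∀ {o t v s} → At o t v s → o ≤ v × v < o + size t
At-range {o} root = ≤-refl , m<m+n o (s≤s z≤n)
At-range {o} (inLeft {l = l} {r} a) with At-range a
... | o<v , v<mid =
  <⇒≤ o<v , <-≤-trans v<mid (≤-trans (m≤m+n _ (size r)) (≤-reflexive (size-node o l r)))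
At-range {o} (inRight {l = l} {r} {v} a) with At-range a
... | mid≤v , v<end =
  ≤-trans (≤-trans (n≤1+n o) (m≤m+n (suc o) (size l))) mid≤v ,
  subst (v <_) (size-node o l r) v<end

At-root : ∀ {o t s} → At o t o s → s ≡ t
At-root root = refl
At-root (inLeft a) = ⊥-elim (<-irrefl refl (proj₁ (At-range a)))
At-root {o} (inRight {l = l} a) =
  ⊥-elim (<-irrefl refl (<-≤-trans (m≤m+n (suc o) (size l)) (proj₁ (At-range a))))

left-right-disjoint : ∀ {o l r v s s'} → At (suc o) l v s → At (suc o + size l) r v s' → ⊥
left-right-disjoint a b = <-irrefl refl (<-≤-trans (proj₂ (At-range a)) (proj₁ (At-range b)))

At-unique : ∀ {o t v s s'} → At o t v s → At o t v s' → s ≡ s'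
At-unique root        b           = sym (At-root b)
At-unique (inLeft a)  root        = At-root (inLeft a)
At-unique (inRight a) root        = At-root (inRight a)
At-unique (inLeft a)  (inLeft b)  = At-unique a b
At-unique (inRight a) (inRight b) = At-unique a b
At-unique (inLeft a)  (inRight b) = ⊥-elim (left-right-disjoint a b)
At-unique (inRight a) (inLeft b)  = ⊥-elim (left-right-disjoint b a)

locate : ∀ o t v → o ≤ v → v < o + size t → ∃ (At o t v)
locate o nil v o≤v v<o+0 = ⊥-elim (<⇒≱ v<o+0 (subst (_≤ v) (sym (+-identityʳ o)) o≤v))
locate o (node l r) v o≤v v<end with o ≟ v
... | yes refl = _ , root
... | no o≢v with v <? suc o + size l
...   | yes v<mid = map₂ inLeft (locate (suc o) l v (≤∧≢⇒< o≤v o≢v) v<mid)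
...   | no v≮mid  =
  map₂ inRight (locate (suc o + size l) r v (≮⇒≥ v≮mid) (subst (v <_) (sym (size-node o l r)) v<end))

At-child : ∀ {o t p sp v s} → At o t p sp → ChildOf p sp v s → At o t v s
At-child root leftChild  = inLeft root
At-child root rightChild = inRight root
At-child (inLeft a)  c   = inLeft (At-child a c)
At-child (inRight a) c   = inRight (At-child a c)

At-parent : ∀ {o t v s} → At o t v s → v ≢ o → ∃₂ λ p sp → At o t p sp × ChildOf p sp v s
At-parent root v≢o = ⊥-elim (v≢o refl)
At-parent (inLeft {l = nil} ())
At-parent {o} (inLeft {l = node _ _} {v = v} a) _ with v ≟ suc o
... | yes refl with At-root a
...   | refl = o , _ , root , leftChild
At-parent (inLeft {l = node _ _} a) _ | no v≢o' with At-parent a v≢o'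
... | p , sp , ap , c = p , sp , inLeft ap , c
At-parent (inRight {r = nil} ())
At-parent {o} (inRight {l = l} {r = node _ _} {v = v} a) _ with v ≟ suc o + size l
... | yes refl with At-root a
...   | refl = o , _ , root , rightChild
At-parent (inRight {r = node _ _} a) _ | no v≢o' with At-parent a v≢o'
... | p , sp , ap , c = p , sp , inRight ap , c

child-< : ∀ {v s c s'} → ChildOf v s c s' → v < c
child-< leftChild              = ≤-refl
child-< (rightChild {l = l})   = s≤s (m≤m+n _ (size l))

edge-inLeft : ∀ {o l r e} → e ∈ edgesAt (suc o) l → e ∈ edgesAt o (node l r)
edge-inLeft {o} {l} {r} m =
  ∈-++⁺ʳ (childEdge o (suc o) l) (∈-++⁺ʳ (childEdge o (suc o + size l) r) (∈-++⁺ˡ m))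

edge-inRight : ∀ {o l r e} → e ∈ edgesAt (suc o + size l) r → e ∈ edgesAt o (node l r)
edge-inRight {o} {l} {r} m =
  ∈-++⁺ʳ (childEdge o (suc o) l)
    (∈-++⁺ʳ (childEdge o (suc o + size l) r) (∈-++⁺ʳ (edgesAt (suc o) l) m))

child-edge : ∀ {o t v s c s'} → At o t v s → ChildOf v s c s' → (v , c) ∈ edgesAt o t
child-edge root leftChild                = here refl
child-edge {o} root (rightChild {l = l}) = ∈-++⁺ʳ (childEdge o (suc o) l) (here refl)
child-edge (inLeft {o} {l} {r} a)  c     = edge-inLeft {o} {l} {r} (child-edge a c)
child-edge (inRight {o} {l} {r} a) c     = edge-inRight {o} {l} {r} (child-edge a c)

data EdgeView (o : ℕ) (l r : BT) : ℕ → ℕ → Set where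
  fromRoot    : ∀ {c s} → ChildOf o (node l r) c s → EdgeView o l r o c
  withinLeft  : ∀ {a b} → (a , b) ∈ edgesAt (suc o) l → EdgeView o l r a b
  withinRight : ∀ {a b} → (a , b) ∈ edgesAt (suc o + size l) r → EdgeView o l r a b

root-edgeˡ : ∀ {o l r a b} → (a , b) ∈ childEdge o (suc o) l → EdgeView o l r a b
root-edgeˡ {l = node _ _} (here refl) = fromRoot leftChild

root-edgeʳ : ∀ {o l r a b} → (a , b) ∈ childEdge o (suc o + size l) r → EdgeView o l r a b
root-edgeʳ {r = node _ _} (here refl) = fromRoot rightChild

edge-view : ∀ {o l r a b} → (a , b) ∈ edgesAt o (node l r) → EdgeView o l r a b
edge-view {o} {l} {r} m with ∈-++⁻ (childEdge o (suc o) l) m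
... | inj₁ e = root-edgeˡ {r = r} e
... | inj₂ m₁ with ∈-++⁻ (childEdge o (suc o + size l) r) m₁
...   | inj₁ e  = root-edgeʳ e
...   | inj₂ m₂ = [ withinLeft , withinRight ]′ (∈-++⁻ (edgesAt (suc o) l) m₂)

edge⇒child : ∀ {o t a b} → (a , b) ∈ edgesAt o t → ∃₂ λ s s' → At o t a s × ChildOf a s b s'
edge⇒child {o} {node l r} m with edge-view {o} {l} {r} m
... | fromRoot c = _ , _ , root , c
... | withinLeft e with edge⇒child e
...   | s , s' , a , c = s , s' , inLeft a , c
edge⇒child {o} {node l r} m | withinRight e with edge⇒child e
...   | s , s' , a , c = s , s' , inRight a , c

edge-range : ∀ o t {a b} → (a , b) ∈ edgesAt o t → o ≤ a × a < b × b < o + size t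
edge-range _ _ m with edge⇒child m
... | _ , _ , a , c = proj₁ (At-range a) , child-< c , proj₂ (At-range (At-child a c))

edge-out : ∀ {o t v s c} → At o t v s → (v , c) ∈ edgesAt o t → ∃ (ChildOf v s c)
edge-out a m with edge⇒child m
... | _ , _ , a' , c with At-unique a a'
...   | refl = _ , c

root-child-not-in-left : ∀ {o l r a b s} → ChildOf o (node l r) b s → (a , b) ∈ edgesAt (suc o) l → ⊥
root-child-not-in-left {o} {l} leftChild e with edge-range (suc o) l e
... | o<a , a<b , _ = <-irrefl refl (≤-<-trans o<a a<b)
root-child-not-in-left {o} {l} rightChild e =
  <-irrefl refl (proj₂ (proj₂ (edge-range (suc o) l e)))

root-child-not-in-right : ∀ {o l r a b s} → ChildOf o (node l r) b s →
                          (a , b) ∈ edgesAt (suc o + size l) r → ⊥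
root-child-not-in-right {o} {l} {r} leftChild e with edge-range (suc o + size l) r e
... | mid≤a , a<b , _ = <-irrefl refl (≤-<-trans (≤-trans (m≤m+n (suc o) (size l)) mid≤a) a<b)
root-child-not-in-right {o} {l} {r} rightChild e with edge-range (suc o + size l) r e
... | mid≤a , a<b , _ = <-irrefl refl (≤-<-trans mid≤a a<b)

left-right-edges-disjoint : ∀ {o l r a a' b} →
  (a , b) ∈ edgesAt (suc o) l → (a' , b) ∈ edgesAt (suc o + size l) r → ⊥
left-right-edges-disjoint {o} {l} {r} e e'
  with edge-range (suc o) l e | edge-range (suc o + size l) r e'
... | _ , _ , b<mid | mid≤a' , a'<b , _ = <-irrefl refl (<-trans b<mid (≤-<-trans mid≤a' a'<b))

parent-unique : ∀ o t {a a' b} → (a , b) ∈ edgesAt o t → (a' , b) ∈ edgesAt o t → a ≡ a'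
parent-unique o (node l r) m m' with edge-view {o} {l} {r} m | edge-view {o} {l} {r} m'
... | fromRoot _    | fromRoot _     = refl
... | fromRoot c    | withinLeft e   = ⊥-elim (root-child-not-in-left c e)
... | fromRoot c    | withinRight e  = ⊥-elim (root-child-not-in-right c e)
... | withinLeft e  | fromRoot c     = ⊥-elim (root-child-not-in-left c e)
... | withinRight e | fromRoot c     = ⊥-elim (root-child-not-in-right c e)
... | withinLeft e  | withinLeft e'  = parent-unique (suc o) l e e'
... | withinRight e | withinRight e' = parent-unique (suc o + size l) r e e'
... | withinLeft e  | withinRight e' = ⊥-elim (left-right-edges-disjoint {o} {l} {r} e e')
... | withinRight e | withinLeft e'  = ⊥-elim (left-right-edges-disjoint {o} {l} {r} e' e)

-- Admissible trees

data Twig : BT → Set where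
  twigˡ : Twig (node leaf nil)
  twigʳ : Twig (node nil leaf)

twig? : Decidable Twig
twig? nil                               = no λ ()
twig? leaf                              = no λ ()
twig? (node nil leaf)                   = yes twigʳ
twig? (node nil (node nil (node _ _)))  = no λ ()
twig? (node nil (node (node _ _) _))    = no λ ()
twig? (node leaf nil)                   = yes twigˡ
twig? (node leaf (node _ _))            = no λ ()
twig? (node (node nil (node _ _)) _)    = no λ ()
twig? (node (node (node _ _) _) _)      = no λ ()

twig-children : ∀ {v s c s'} → Twig s → ChildOf v s c s' → c ≡ suc v
twig-children twigˡ leftChild        = refl
twig-children {v} twigʳ rightChild   = +-identityʳ (suc v)

twig-child : ∀ {v s} → Twig s → ∃ (ChildOf v s (suc v))
twig-child twigˡ     = _ , leftChild
twig-child {v} twigʳ =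
  _ , subst (λ c → ChildOf v (node nil leaf) c leaf) (+-identityʳ (suc v)) rightChild

data Admissible : BT → Set where
  empty  : Admissible nil
  single : Admissible leaf
  twig   : ∀ {t} → Twig t → Admissible t
  branch : ∀ {a b c d} → Admissible (node a b) → Admissible (node c d) →
           (Twig (node a b) → ¬ Twig (node c d)) → Admissible (node (node a b) (node c d))

admissible-left : ∀ {l r} → Admissible (node l r) → Admissible l
admissible-left single          = empty
admissible-left (twig twigˡ)    = single
admissible-left (twig twigʳ)    = empty
admissible-left (branch al _ _) = al

admissible-right : ∀ {l r} → Admissible (node l r) → Admissible r
admissible-right single          = empty
admissible-right (twig twigˡ)    = empty
admissible-right (twig twigʳ)    = single
admissible-right (branch _ ar _) = ar

admissible-at : ∀ {o t v s} → Admissible t → At o t v s → Admissible s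
admissible-at adm root        = adm
admissible-at adm (inLeft a)  = admissible-at (admissible-left adm) a
admissible-at adm (inRight a) = admissible-at (admissible-right adm) a

no-twin-twigs : ∀ {l r} → Admissible (node l r) → Twig l → does (twig? r) ≡ false
no-twin-twigs (branch _ _ ¬twins) tl = dec-false (twig? _) (¬twins tl)
no-twin-twigs single ()
no-twin-twigs (twig twigˡ) ()
no-twin-twigs (twig twigʳ) ()

-- Full and complete trees are admissible

full⇒¬twig : ∀ {t} → Full t → ¬ Twig t
full⇒¬twig full-leaf ()
full⇒¬twig (full-node _ _) ()

full⇒admissible : ∀ {t} → Full t → Admissible t
full⇒admissible full-nil        = empty
full⇒admissible full-leaf       = single
full⇒admissible (full-node f g) =
  branch (full⇒admissible f) (full⇒admissible g) (λ _ → full⇒¬twig g)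

⊑-length : ∀ {p q} → p ⊑ q → length p ≡ length q
⊑-length []⊑[]     = refl
⊑-length (L⊑R eq)  = cong suc eq
⊑-length (same p⊑q) = cong suc (⊑-length p⊑q)

absent-before-present : ∀ {t} → Complete t → ∀ p q → ¬ Present t p → Present t q → p ⊑ q → ⊥
absent-before-present (h , filled , bottom , leftmost) p q ¬p q∈t p⊑q with <-cmp (length p) h
... | tri< p<h _ _ = ¬p (filled p p<h)
... | tri≈ _ p≡h _ = ¬p (leftmost q p (trans (sym (⊑-length p⊑q)) p≡h) p⊑q q∈t)
... | tri> _ _ h<p = bottom q (subst (h <_) (⊑-length p⊑q) h<p) q∈t

absent-above-present : ∀ {t} → Complete t → ∀ p q → ¬ Present t p → Present t q →
                       length p < length q → ⊥
absent-above-present (h , filled , bottom , _) p q ¬p q∈t p<q with length p <? h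
... | yes p<h = ¬p (filled p p<h)
... | no p≮h  = bottom q (≤-<-trans (≮⇒≥ p≮h) p<q) q∈t

complete-subtree : ∀ b {t s} → (∀ p → Present t (b ∷ p) ≡ Present s p) → Complete t → Complete s
complete-subtree b {s = s} at-b (zero , _ , bottom , _) =
  zero , (λ _ ()) , (λ p _ p∈s → bottom (b ∷ p) (s≤s z≤n) (subst id (sym (at-b p)) p∈s))
       , only-root
  where
  only-root : ∀ p q → length p ≡ 0 → q ⊑ p → Present s p → Present s q
  only-root [] [] _ []⊑[] p∈s = p∈s
complete-subtree b {t} {s} at-b (suc h , filled , bottom , leftmost) =
  h , (λ p p<h → into (filled (b ∷ p) (s≤s p<h)))
    , (λ p h<p p∈s → bottom (b ∷ p) (s≤s h<p) (out p∈s))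
    , (λ p q p≡h q⊑p p∈s → into (leftmost (b ∷ p) (b ∷ q) (cong suc p≡h) (same q⊑p) (out p∈s)))
  where
  into : ∀ {p} → Present t (b ∷ p) → Present s p
  into {p} = subst id (at-b p)

  out : ∀ {p} → Present s p → Present t (b ∷ p)
  out {p} = subst id (sym (at-b p))

only-child-is-leaf : ∀ {a b} → Complete (node (node a b) nil) → a ≡ nil × b ≡ nil
only-child-is-leaf {nil} {nil} k = refl , refl
only-child-is-leaf {a@(node _ _)} {b} k = ⊥-elim
  (absent-above-present {node (node a b) nil} k (true ∷ []) (false ∷ false ∷ []) (λ ()) tt ≤-refl)
only-child-is-leaf {nil} {b@(node _ _)} k = ⊥-elim
  (absent-above-present {node (node nil b) nil} k (true ∷ []) (false ∷ true ∷ []) (λ ()) tt ≤-refl)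

twig-gap : ∀ {s} → Twig s → ∃ λ b → ¬ Present s (b ∷ [])
twig-gap twigˡ = true , λ ()
twig-gap twigʳ = false , λ ()

twig-child-present : ∀ {s} → Twig s → ∃ λ b → Present s (b ∷ [])
twig-child-present twigˡ = false , tt
twig-child-present twigʳ = true , tt

complete-no-twin-twigs : ∀ {l r} → Complete (node l r) → Twig l → ¬ Twig r
complete-no-twin-twigs {l} {r} k tl tr with twig-gap tl | twig-child-present tr
... | b , gap | b' , child =
  absent-before-present {node l r} k (false ∷ b ∷ []) (true ∷ b' ∷ []) gap child (L⊑R refl)

complete⇒admissible : ∀ {t} → Complete t → Admissible t
complete⇒admissible {nil}  _ = empty
complete⇒admissible {leaf} _ = single
complete⇒admissible {node nil r@(node _ _)} k =
  ⊥-elim (absent-before-present {node nil r} k (false ∷ []) (true ∷ []) (λ ()) tt (L⊑R refl))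
complete⇒admissible {node (node _ _) nil} k with only-child-is-leaf k
... | refl , refl = twig twigˡ
complete⇒admissible {node l@(node _ _) r@(node _ _)} k =
  branch (complete⇒admissible (complete-subtree false {node l r} {l} (λ _ → refl) k))
         (complete⇒admissible (complete-subtree true {node l r} {r} (λ _ → refl) k))
         (complete-no-twin-twigs k)

-- The tour

arrange : Bool → List ℕ → List ℕ → List ℕ
arrange false xs ys = reverse xs ++ ys
arrange true  xs ys = reverse ys ++ xs

tour : ℕ → BT → List ℕ
tour o nil        = []
tour o (node l r) = o ∷ arrange (does (twig? r)) (tour (suc o) l) (tour (suc o + size l) r)

length-arrange : ∀ b xs ys → length (arrange b xs ys) ≡ length xs + length ys
length-arrange false xs ys = trans (length-++ (reverse xs)) (cong (_+ length ys) (length-reverse xs))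
length-arrange true  xs ys = trans (length-++ (reverse ys))
  (trans (cong (_+ length xs) (length-reverse ys)) (+-comm (length ys) (length xs)))

length-tour : ∀ o t → length (tour o t) ≡ size t
length-tour o nil        = refl
length-tour o (node l r) = cong suc (trans
  (length-arrange (does (twig? r)) (tour (suc o) l) (tour (suc o + size l) r))
  (cong₂ _+_ (length-tour (suc o) l) (length-tour (suc o + size l) r)))

∈-arrangeˡ : ∀ b {x xs ys} → x ∈ xs → x ∈ arrange b xs ys
∈-arrangeˡ false p = ∈-++⁺ˡ (reverse⁺ p)
∈-arrangeˡ true {ys = ys} p = ∈-++⁺ʳ (reverse ys) p

∈-arrangeʳ : ∀ b {x xs ys} → x ∈ ys → x ∈ arrange b xs ys
∈-arrangeʳ false {xs = xs} p = ∈-++⁺ʳ (reverse xs) p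
∈-arrangeʳ true p = ∈-++⁺ˡ (reverse⁺ p)

tour-∋ : ∀ {o t v s} → At o t v s → v ∈ tour o t
tour-∋ root                = here refl
tour-∋ (inLeft {r = r} a)  = there (∈-arrangeˡ (does (twig? r)) (tour-∋ a))
tour-∋ (inRight {r = r} a) = there (∈-arrangeʳ (does (twig? r)) (tour-∋ a))

tour-twig : ∀ {v s} → Twig s → tour v s ≡ v ∷ suc v ∷ []
tour-twig twigˡ     = refl
tour-twig {v} twigʳ = cong (λ c → v ∷ c ∷ []) (+-identityʳ (suc v))

Adjacent : ℕ → ℕ → List ℕ → Set
Adjacent x y zs = Infix _≡_ (x ∷ y ∷ []) zs ⊎ Infix _≡_ (y ∷ x ∷ []) zs

pair-infix : ∀ {x y : ℕ} xs ys → Infix _≡_ (x ∷ y ∷ []) (xs ++ x ∷ y ∷ ys)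
pair-infix xs ys = xs ++ⁱ here (refl ∷ refl ∷ [])

infix-reverse : ∀ {x y : ℕ} {zs} → Infix _≡_ (x ∷ y ∷ []) zs →
                Infix _≡_ (y ∷ x ∷ []) (reverse zs)
infix-reverse {x} {y} {zs = _ ∷ _ ∷ zs} (here (refl ∷ refl ∷ [])) =
  subst (Infix _≡_ _) (sym (reverse-++ (x ∷ y ∷ []) zs)) (pair-infix (reverse zs) [])
infix-reverse {zs = z ∷ zs} (there i) =
  subst (Infix _≡_ _) (sym (reverse-++ (z ∷ []) zs)) (infix-reverse i ⁱ++ (z ∷ []))

adjacent-reverse : ∀ {x y zs} → Adjacent x y zs → Adjacent x y (reverse zs)
adjacent-reverse = swap ∘ ⊎-map infix-reverse infix-reverse

adjacent-∷ : ∀ {x y z zs} → Adjacent x y zs → Adjacent x y (z ∷ zs)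
adjacent-∷ = ⊎-map there there

adjacent-++ˡ : ∀ {x y xs} ys → Adjacent x y xs → Adjacent x y (xs ++ ys)
adjacent-++ˡ ys = ⊎-map (_ⁱ++ ys) (_ⁱ++ ys)

adjacent-++ʳ : ∀ {x y ys} xs → Adjacent x y ys → Adjacent x y (xs ++ ys)
adjacent-++ʳ xs = ⊎-map (xs ++ⁱ_) (xs ++ⁱ_)

adjacent-arrangeˡ : ∀ b {x y xs ys} → Adjacent x y xs → Adjacent x y (arrange b xs ys)
adjacent-arrangeˡ false {ys = ys} = adjacent-++ˡ ys ∘ adjacent-reverse
adjacent-arrangeˡ true  {ys = ys} = adjacent-++ʳ (reverse ys)

adjacent-arrangeʳ : ∀ b {x y xs ys} → Adjacent x y ys → Adjacent x y (arrange b xs ys)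
adjacent-arrangeʳ false {xs = xs} = adjacent-++ʳ (reverse xs)
adjacent-arrangeʳ true  {xs = xs} = adjacent-++ˡ xs ∘ adjacent-reverse

reverse-∷-infix : ∀ {x y : ℕ} xs ys → Infix _≡_ (x ∷ y ∷ []) (reverse (x ∷ xs) ++ y ∷ ys)
reverse-∷-infix {x} {y} xs ys = subst (Infix _≡_ _) (sym unfold) (pair-infix (reverse xs) ys)
  where
  unfold : reverse (x ∷ xs) ++ y ∷ ys ≡ reverse xs ++ x ∷ y ∷ ys
  unfold = trans (cong (_++ y ∷ ys) (unfold-reverse x xs))
                 (++-assoc (reverse xs) (x ∷ []) (y ∷ ys))

arrange-heads : ∀ b {x y} xs ys → Adjacent x y (arrange b (x ∷ xs) (y ∷ ys))
arrange-heads false xs ys = inj₁ (reverse-∷-infix xs ys)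
arrange-heads true  xs ys = inj₂ (reverse-∷-infix ys xs)

tour-children : ∀ {o t v a b c d} → At o t v (node (node a b) (node c d)) →
                Adjacent (suc v) (suc v + size (node a b)) (tour o t)
tour-children {c = c} {d} root = adjacent-∷ (arrange-heads (does (twig? (node c d))) _ _)
tour-children (inLeft {r = r} a)  = adjacent-∷ (adjacent-arrangeˡ (does (twig? r)) (tour-children a))
tour-children (inRight {r = r} a) = adjacent-∷ (adjacent-arrangeʳ (does (twig? r)) (tour-children a))

tour-root-twig : ∀ {o l r v s} → Admissible (node l r) → ChildOf o (node l r) v s → Twig s →
                 Infix _≡_ (o ∷ suc v ∷ []) (tour o (node l r))
tour-root-twig {o} {l} {r} adm leftChild tw =
  subst (Infix _≡_ _) (sym unfold) (here (refl ∷ refl ∷ []))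
  where
  right = tour (suc o + size l) r

  unfold : tour o (node l r) ≡ o ∷ arrange false (suc o ∷ suc (suc o) ∷ []) right
  unfold = cong₂ (λ b xs → o ∷ arrange b xs right) (no-twin-twigs adm tw) (tour-twig tw)
tour-root-twig {o} {l} {r} {v} adm rightChild tw =
  subst (Infix _≡_ _) (sym unfold) (here (refl ∷ refl ∷ []))
  where
  unfold : tour o (node l r) ≡ o ∷ arrange true (tour (suc o) l) (v ∷ suc v ∷ [])
  unfold = cong₂ (λ b ys → o ∷ arrange b (tour (suc o) l) ys) (dec-true (twig? r) tw) (tour-twig tw)

tour-twig-parent : ∀ {o t p sp v s} → Admissible t → At o t p sp → ChildOf p sp v s → Twig s →
                   Adjacent p (suc v) (tour o t)
tour-twig-parent adm root c tw = inj₁ (tour-root-twig adm c tw)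
tour-twig-parent adm (inLeft {r = r} a) c tw =
  adjacent-∷ (adjacent-arrangeˡ (does (twig? r)) (tour-twig-parent (admissible-left adm) a c tw))
tour-twig-parent adm (inRight {r = r} a) c tw =
  adjacent-∷ (adjacent-arrangeʳ (does (twig? r)) (tour-twig-parent (admissible-right adm) a c tw))

-- Admissible trees are neighborhood-prime

Edge : BT → ℕ → ℕ → Set
Edge t x v = (x , v) ∈ edges t ⊎ (v , x) ∈ edges t

edge-bound : ∀ t {x v} → Edge t x v → x < size t
edge-bound t (inj₁ m) with edge-range 0 t m
... | _ , x<v , v<size = <-trans x<v v<size
edge-bound t (inj₂ m) = proj₂ (proj₂ (edge-range 0 t m))

as-vertex : ∀ {t x v} → Edge t x v → ∃ λ (u : Fin (size t)) → toℕ u ≡ x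
as-vertex {t} e = fromℕ< (edge-bound t e) , toℕ-fromℕ< _

consecutive-neighbours : ∀ {t x y} (v : Fin (size t)) → Edge t x (toℕ v) → Edge t y (toℕ v) →
                         Adjacent x y (tour 0 t) → ConsecutiveNeighbours (treeGraph t) (tour 0 t) v
consecutive-neighbours {t} v ex ey = via-vertices (as-vertex {t} ex) (as-vertex {t} ey) ex ey
  where
  via-vertices : ∀ {x y} → (∃ λ u → toℕ u ≡ x) → (∃ λ w → toℕ w ≡ y) →
                 Edge t x (toℕ v) → Edge t y (toℕ v) →
                 Adjacent x y (tour 0 t) → ConsecutiveNeighbours (treeGraph t) (tour 0 t) v
  via-vertices (u , refl) (w , refl) ex ey =
    [ (λ i → u , w , ex , ey , i) , (λ i → w , u , ey , ex , i) ]′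

leaf-parent-edge : ∀ {t v x} → At 0 t v leaf → Edge t x v → (x , v) ∈ edges t
leaf-parent-edge a (inj₁ m) = m
leaf-parent-edge a (inj₂ m) with edge-out a m
... | _ , ()

root-twig-neighbour : ∀ {t v s x} → At 0 t v s → Twig s → v ≡ 0 → Edge t x v → x ≡ suc v
root-twig-neighbour {t} {v} {x = x} a tw v≡0 (inj₁ m) =
  ⊥-elim (n≮0 (subst (x <_) v≡0 (proj₁ (proj₂ (edge-range 0 t m)))))
root-twig-neighbour a tw v≡0 (inj₂ m) with edge-out a m
... | _ , c = twig-children tw c

admissible-neighbours : ∀ {t} → Admissible t → ∀ v →
  AtMostOneNeighbour (treeGraph t) v ⊎ ConsecutiveNeighbours (treeGraph t) (tour 0 t) v
admissible-neighbours {t} adm v with locate 0 t (toℕ v) z≤n (toℕ<n v)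
... | s , a with admissible-at adm a
...   | empty = ⊥-elim (At-nil a)
...   | single = inj₁ λ eu ew →
  toℕ-injective (parent-unique 0 t (leaf-parent-edge a eu) (leaf-parent-edge a ew))
...   | branch _ _ _ = inj₂ (consecutive-neighbours v
  (inj₂ (child-edge a leftChild)) (inj₂ (child-edge a rightChild)) (tour-children a))
...   | twig tw with toℕ v ≟ 0
...     | yes v≡0 = inj₁ λ eu ew →
  toℕ-injective (trans (root-twig-neighbour a tw v≡0 eu) (sym (root-twig-neighbour a tw v≡0 ew)))
...     | no v≢0 with At-parent a v≢0
...       | p , sp , ap , c = inj₂ (consecutive-neighbours v
  (inj₁ (child-edge ap c)) (inj₂ (child-edge a (proj₂ (twig-child tw)))) (tour-twig-parent adm ap c tw))

admissible⇒neighborhoodPrime : ∀ {t} → Admissible t → NeighborhoodPrime (treeGraph t)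
admissible⇒neighborhoodPrime {t} adm =
  neighborhoodPrime-fromCovering (treeGraph t) (tour 0 t) (length-tour 0 t)
    (λ v → tour-∋ (proj₂ (locate 0 t (toℕ v) z≤n (toℕ<n v)))) (admissible-neighbours adm)

mainTheorem17 : (∀ (t : BT) → Full t → NeighborhoodPrime (treeGraph t))
              × (∀ (t : BT) → Complete t → NeighborhoodPrime (treeGraph t))
mainTheorem17 = (λ _ → admissible⇒neighborhoodPrime ∘ full⇒admissible)
              , (λ _ → admissible⇒neighborhoodPrime ∘ complete⇒admissible)
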